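{- For all $n\ge 2$, $WL(FQ_n,Q_n)=n2^n$.
   Context: $Q_n$ is the $n$-dimensional hypercube: vertex set $\{0,1\}^n$, two vertices adjacent iff they differ in exactly one coordinate. The folded hypercube $FQ_n$ is obtained from $Q_n$ by adding, for every vertex $x=x_1\dots x_n$, the edge between $x$ and its antipodal vertex $\overline{x}=(1-x_1)\dots(1-x_n)$. An embedding of a graph $G$ into a graph $H$ is a pair $(f,P_f)$ where $f:V(G)\to V(H)$ is injective and $P_f$ assigns to each edge $uv\in E(G)$ a path in $H$ between $f(u)$ and $f(v)$. The wirelength of the embedding is $WL_f(G,H)=\sum_{e\in E(G)}|P_f(e)|$, and $WL(G,H)$ is the minimum of $WL_f(G,H)$ over all embeddings of $G$ into $H$. -}

module Defs where

open import Data.Nat using (ℕ; zero; suc; _+_; _≡ᵇ_)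
open import Data.Bool using (Bool; true; false; not; _∧_; _∨_; T; if_then_else_)
open import Data.Bool.Properties using () renaming (_≟_ to _≟B_)
open import Data.Vec using (Vec; []; _∷_; map)
open import Data.Vec.Properties using (≡-dec)
open import Data.List using (List; []; _∷_; _++_; cartesianProductWith)
open import Data.Nat.ListAction using (sum)
open import Data.List.Relation.Unary.Unique.Propositional using (Unique)
open import Data.Product using (Σ; _,_; proj₁)
open import Relation.Binary.PropositionalEquality using (_≡_)
open import Relation.Nullary using (Dec; yes; no; does)
open import Relation.Nullary.Decidable using (T?)
open import Function.Definitions using (Injective)

Vtx : ℕ → Set
Vtx n = Vec Bool n

allVtx : (n : ℕ) → List (Vtx n)
allVtx zero = [] ∷ []
allVtx (suc n) = Data.List.map (false ∷_) (allVtx n) ++ Data.List.map (true ∷_) (allVtx n)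

hamming : ∀ {n} → Vtx n → Vtx n → ℕ
hamming [] [] = 0
hamming (a ∷ x) (b ∷ y) = (if does (a ≟B b) then 0 else 1) + hamming x y

complement : ∀ {n} → Vtx n → Vtx n
complement = map not

qAdjᵇ : ∀ {n} → Vtx n → Vtx n → Bool
qAdjᵇ x y = hamming x y ≡ᵇ 1

QAdj : ∀ {n} → Vtx n → Vtx n → Set
QAdj x y = T (qAdjᵇ x y)

fqAdjᵇ : ∀ {n} → Vtx n → Vtx n → Bool
fqAdjᵇ x y = qAdjᵇ x y ∨ does (≡-dec _≟B_ y (complement x))

-- Strict lexicographic order (false < true), used only to pick one
-- orientation of each undirected edge.
lexLtᵇ : ∀ {n} → Vtx n → Vtx n → Bool
lexLtᵇ [] [] = false
lexLtᵇ (false ∷ x) (false ∷ y) = lexLtᵇ x y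
lexLtᵇ (true ∷ x) (true ∷ y) = lexLtᵇ x y
lexLtᵇ (false ∷ x) (true ∷ y) = true
lexLtᵇ (true ∷ x) (false ∷ y) = false

-- (x , y) with x <lex y represents the undirected edge {x , y} of FQ_n.
FQEdge : ∀ {n} → Vtx n → Vtx n → Set
FQEdge x y = T (lexLtᵇ x y ∧ fqAdjᵇ x y)

data Walk {n : ℕ} : Vtx n → Vtx n → Set where
  nil  : (x : Vtx n) → Walk x x
  cons : {x y z : Vtx n} → QAdj x y → Walk y z → Walk x z

walkVertices : ∀ {n} {x y : Vtx n} → Walk x y → List (Vtx n)
walkVertices (nil x) = x ∷ []
walkVertices (cons {x = x} _ w) = x ∷ walkVertices w

walkLength : ∀ {n} {x y : Vtx n} → Walk x y → ℕ
walkLength (nil _) = 0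
walkLength (cons _ w) = suc (walkLength w)

QPath : ∀ {n} → Vtx n → Vtx n → Set
QPath x y = Σ (Walk x y) (λ w → Unique (walkVertices w))

pathLength : ∀ {n} {x y : Vtx n} → QPath x y → ℕ
pathLength p = walkLength (proj₁ p)

record Embedding (n : ℕ) : Set where
  field
    f     : Vtx n → Vtx n
    f-inj : Injective _≡_ _≡_ f
    P     : (x y : Vtx n) → FQEdge x y → QPath (f x) (f y)

edgeCost : ∀ {n} (E : Embedding n) (x y : Vtx n) → Dec (FQEdge x y) → ℕ
edgeCost E x y (yes e) = pathLength (Embedding.P E x y e)
edgeCost E x y (no _)  = 0

wirelength : ∀ {n} → Embedding n → ℕ
wirelength {n} E =
  sum (cartesianProductWith (λ x y → edgeCost E x y (T? (lexLtᵇ x y ∧ fqAdjᵇ x y))) (allVtx n) (allVtx n))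

IsMinWirelength : (n w : ℕ) → Set
IsMinWirelength n w = Σ (Embedding n) (λ E → wirelength E ≡ w) Data.Product.× ((E : Embedding n) → w Data.Nat.≤ wirelength E)

module Submission where

-- The identity embedding, routing every edge along a geodesic, costs 1 for each of the n 2ⁿ⁻¹
-- cube edges and n for each of the 2ⁿ⁻¹ antipodal edges, n 2ⁿ in total.
--
-- Conversely, a path is at least as long as the Hamming distance of its ends, which counts the
-- coordinates i in which fᵢ differs at the two ends. Since f is injective every coordinate fᵢ is
-- balanced, so it suffices that a balanced g : ℤ₂ⁿ → ℤ₂ cuts at least 2ⁿ edges of FQₙ. Let
-- F(s) = ĝ(s)² be the Walsh spectrum of (-1)^g. Parseval gives Σₛ F(s) = 4ⁿ and balance gives
-- F(0) = 0, while twice the number of cut edges is 2⁻ⁿ Σₛ w(s) F(s), where w(s) counts the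
-- generators a ∈ {e₁, …, eₙ, 𝟙} of FQₙ with s·a odd. A nonzero s has weight at least 2, or is
-- some eᵢ and then s·𝟙 is odd too; either way w(s) ≥ 2.

open import Defs
open import Algebra.Bundles using (CommutativeSemiring)
open import Data.Bool using (false; true)
open import Data.Nat using (zero; suc)
open import Data.Vec using ([]; _∷_; replicate)
open import Function using (_∘_; id; case_of_)

zeros : ∀ n → Vtx n
zeros n = replicate n false

ones : ∀ n → Vtx n
ones n = replicate n true

-- Sums over the cube

module CubeSum {c ℓ} (R : CommutativeSemiring c ℓ) where
  open CommutativeSemiring R
  open import Algebra.Properties.CommutativeSemigroup +-commutativeSemigroup using (interchange)
  open import Relation.Binary.Reasoning.Setoid setoid

  ∑ : ∀ {n} → (Vtx n → Carrier) → Carrier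
  ∑ {zero}  h = h []
  ∑ {suc n} h = ∑ (h ∘ (false ∷_)) + ∑ (h ∘ (true ∷_))

  ∑-cong : ∀ {n} {h k : Vtx n → Carrier} → (∀ x → h x ≈ k x) → ∑ h ≈ ∑ k
  ∑-cong {zero}  h≈k = h≈k []
  ∑-cong {suc n} h≈k = +-cong (∑-cong (h≈k ∘ (false ∷_))) (∑-cong (h≈k ∘ (true ∷_)))

  ∑-distrib-+ : ∀ {n} (h k : Vtx n → Carrier) → ∑ (λ x → h x + k x) ≈ ∑ h + ∑ k
  ∑-distrib-+ {zero}  h k = refl
  ∑-distrib-+ {suc n} h k = begin
    ∑ (λ x → h₀ x + k₀ x) + ∑ (λ x → h₁ x + k₁ x) ≈⟨ +-cong (∑-distrib-+ h₀ k₀) (∑-distrib-+ h₁ k₁) ⟩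
    (∑ h₀ + ∑ k₀) + (∑ h₁ + ∑ k₁)                 ≈⟨ interchange (∑ h₀) (∑ k₀) (∑ h₁) (∑ k₁) ⟩
    ∑ h + ∑ k                                     ∎
    where
    h₀ h₁ k₀ k₁ : Vtx n → Carrier
    h₀ = h ∘ (false ∷_)
    h₁ = h ∘ (true ∷_)
    k₀ = k ∘ (false ∷_)
    k₁ = k ∘ (true ∷_)

  ∑-zero : ∀ n → ∑ {n} (λ _ → 0#) ≈ 0#
  ∑-zero zero    = refl
  ∑-zero (suc n) = trans (+-cong (∑-zero n) (∑-zero n)) (+-identityˡ 0#)

  *-distribˡ-∑ : ∀ {n} c (h : Vtx n → Carrier) → c * ∑ h ≈ ∑ (λ x → c * h x)
  *-distribˡ-∑ {zero}  c h = refl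
  *-distribˡ-∑ {suc n} c h =
    trans (distribˡ c _ _) (+-cong (*-distribˡ-∑ c (h ∘ (false ∷_))) (*-distribˡ-∑ c (h ∘ (true ∷_))))

  ∑-comm : ∀ {m n} (K : Vtx m → Vtx n → Carrier) → ∑ (λ x → ∑ (K x)) ≈ ∑ (λ y → ∑ λ x → K x y)
  ∑-comm {zero}  K = refl
  ∑-comm {suc m} K =
    trans (+-cong (∑-comm (K ∘ (false ∷_))) (∑-comm (K ∘ (true ∷_))))
          (sym (∑-distrib-+ (λ y → ∑ λ x → K (false ∷ x) y) (λ y → ∑ λ x → K (true ∷ x) y)))

  -- FQₙ is the Cayley graph of ℤ₂ⁿ for the generators e₁, …, eₙ, summed over by ∑ₑ, and
  -- 𝟙 = ones n; ∑ₛ sums over all of them.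
  ∑ₑ : ∀ {n} → (Vtx n → Carrier) → Carrier
  ∑ₑ {zero}  h = 0#
  ∑ₑ {suc n} h = h (true ∷ zeros n) + ∑ₑ (h ∘ (false ∷_))

  ∑ₛ : ∀ {n} → (Vtx n → Carrier) → Carrier
  ∑ₛ h = ∑ₑ h + h (ones _)

  ∑ₑ-cong : ∀ {n} {h k : Vtx n → Carrier} → (∀ x → h x ≈ k x) → ∑ₑ h ≈ ∑ₑ k
  ∑ₑ-cong {zero}  h≈k = refl
  ∑ₑ-cong {suc n} h≈k = +-cong (h≈k _) (∑ₑ-cong (h≈k ∘ (false ∷_)))

  ∑ₑ-distrib-+ : ∀ {n} (h k : Vtx n → Carrier) → ∑ₑ (λ x → h x + k x) ≈ ∑ₑ h + ∑ₑ k
  ∑ₑ-distrib-+ {zero}  h k = sym (+-identityˡ 0#)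
  ∑ₑ-distrib-+ {suc n} h k =
    trans (+-congˡ (∑ₑ-distrib-+ (h ∘ (false ∷_)) (k ∘ (false ∷_)))) (interchange _ _ _ _)

  *-distribˡ-∑ₑ : ∀ {n} c (h : Vtx n → Carrier) → c * ∑ₑ h ≈ ∑ₑ (λ x → c * h x)
  *-distribˡ-∑ₑ {zero}  c h = zeroʳ c
  *-distribˡ-∑ₑ {suc n} c h = trans (distribˡ c _ _) (+-congˡ (*-distribˡ-∑ₑ c (h ∘ (false ∷_))))

  ∑ₑ-∑-comm : ∀ {m n} (K : Vtx m → Vtx n → Carrier) → ∑ₑ (λ a → ∑ (K a)) ≈ ∑ (λ x → ∑ₑ λ a → K a x)
  ∑ₑ-∑-comm {zero}  {n} K = sym (∑-zero n)
  ∑ₑ-∑-comm {suc m}     K =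
    trans (+-congˡ (∑ₑ-∑-comm (K ∘ (false ∷_))))
          (sym (∑-distrib-+ (K (true ∷ zeros m)) (λ x → ∑ₑ λ a → K (false ∷ a) x)))

  ∑ₛ-cong : ∀ {n} {h k : Vtx n → Carrier} → (∀ x → h x ≈ k x) → ∑ₛ h ≈ ∑ₛ k
  ∑ₛ-cong h≈k = +-cong (∑ₑ-cong h≈k) (h≈k _)

  ∑ₛ-distrib-+ : ∀ {n} (h k : Vtx n → Carrier) → ∑ₛ (λ x → h x + k x) ≈ ∑ₛ h + ∑ₛ k
  ∑ₛ-distrib-+ h k = trans (+-congʳ (∑ₑ-distrib-+ h k)) (interchange _ _ _ _)

  *-distribˡ-∑ₛ : ∀ {n} c (h : Vtx n → Carrier) → c * ∑ₛ h ≈ ∑ₛ (λ x → c * h x)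
  *-distribˡ-∑ₛ c h = trans (distribˡ c _ _) (+-congʳ (*-distribˡ-∑ₑ c h))

  ∑ₛ-∑-comm : ∀ {m n} (K : Vtx m → Vtx n → Carrier) → ∑ₛ (λ a → ∑ (K a)) ≈ ∑ (λ x → ∑ₛ λ a → K a x)
  ∑ₛ-∑-comm {m} K =
    trans (+-congʳ (∑ₑ-∑-comm K)) (sym (∑-distrib-+ (λ x → ∑ₑ λ a → K a x) (K (ones m))))

open import Data.Bool using (Bool; not; _∧_; _∨_; _xor_; T; if_then_else_)
open import Data.Bool.Properties using (xor-identityʳ; ∧-zeroʳ; ∧-identityʳ; not-¬) renaming (_≟_ to _≟B_)
open import Data.Empty using (⊥; ⊥-elim)
open import Data.Fin using (Fin; zero; suc)
open import Data.Integer as ℤ using (ℤ; _-_; ∣_∣; 1ℤ; -1ℤ)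
import Data.Integer.Properties as ℤ
import Data.Integer.Tactic.RingSolver as ℤ-Solver
open import Data.List as List using (List; _++_; cartesianProductWith)
open import Data.List.Properties using (map-++; map-∘; map-cong)
open import Data.List.Relation.Unary.All using (All; universal; [])
open import Data.List.Relation.Unary.All.Properties using () renaming (map⁺ to All-map⁺)
open import Data.List.Relation.Unary.Unique.Propositional using (Unique; []; _∷_)
open import Data.List.Relation.Unary.Unique.Propositional.Properties using () renaming (map⁺ to Unique-map⁺)
open import Data.Nat using (ℕ; _+_; _*_; _^_; _≤_; z≤n; s≤s; _≡ᵇ_)
open import Data.Nat.ListAction using (sum)
open import Data.Nat.ListAction.Properties using (sum-++)
open import Data.Nat.Properties
open import Data.Nat.Tactic.RingSolver using (solve-∀)
open import Data.Product using (∃; _,_; _×_; proj₁; proj₂)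
open import Data.Sum using (_⊎_; inj₁; inj₂)
open import Data.Vec using (zipWith; lookup; tail)
open import Data.Vec.Properties using (≡-dec; ∷-injectiveˡ; ∷-injectiveʳ)
open import Function.Definitions using (Injective)
open import Relation.Binary.PropositionalEquality
open import Relation.Nullary using (Dec; yes; no; does; ¬_)
open import Relation.Nullary.Decidable using (T?)
open import Algebra.Properties.AbelianGroup ℤ.+-0-abelianGroup using (identityˡ-unique)
open import Algebra.Properties.CommutativeSemigroup +-commutativeSemigroup using ()
  renaming (interchange to +-interchange)
open import Algebra.Properties.CommutativeSemigroup *-commutativeSemigroup using ()
  renaming (x∙yz≈y∙xz to *-left-comm)

open CubeSum +-*-commutativeSemiring
open CubeSum ℤ.+-*-commutativeSemiring using ()
  renaming (∑ to ∑ᶻ; ∑-cong to ∑ᶻ-cong; ∑-distrib-+ to ∑ᶻ-distrib-+; *-distribˡ-∑ to *-distribˡ-∑ᶻ)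

infixl 7 _when_
infixl 6 _⊕_

_when_ : ℕ → Bool → ℕ
c when true  = c
c when false = 0

count : ∀ {n} → (Vtx n → Bool) → ℕ
count P = ∑ λ x → 1 when P x

_⊕_ : ∀ {n} → Vtx n → Vtx n → Vtx n
_⊕_ = zipWith _xor_

_·_ : ∀ {n} → Vtx n → Vtx n → Bool
[]      · []      = false
(b ∷ s) · (a ∷ x) = (b ∧ a) xor (s · x)

weight : ∀ {n} → Vtx n → ℕ
weight []      = 0
weight (b ∷ s) = 1 when b + weight s

-- The summand of hamming, so that hamming (a ∷ x) (b ∷ y) reduces to bitDist a b + hamming x y.
bitDist : Bool → Bool → ℕ
bitDist a b = if does (a ≟B b) then 0 else 1

_≟ᵛ_ : ∀ {n} (x y : Vtx n) → Dec (x ≡ y)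
_≟ᵛ_ = ≡-dec _≟B_

≟ᵛ⇒≡ : ∀ {n} {x y : Vtx n} → T (does (x ≟ᵛ y)) → x ≡ y
≟ᵛ⇒≡ {x = x} {y} _ with x ≟ᵛ y
... | yes x≡y = x≡y

⊕-identityʳ : ∀ {n} (x : Vtx n) → x ⊕ zeros n ≡ x
⊕-identityʳ []      = refl
⊕-identityʳ (b ∷ x) = cong₂ _∷_ (xor-identityʳ b) (⊕-identityʳ x)

complement≡⊕ones : ∀ {n} (x : Vtx n) → complement x ≡ x ⊕ ones n
complement≡⊕ones []          = refl
complement≡⊕ones (false ∷ x) = cong (true ∷_) (complement≡⊕ones x)
complement≡⊕ones (true ∷ x)  = cong (false ∷_) (complement≡⊕ones x)

weight-zeros : ∀ n → weight (zeros n) ≡ 0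
weight-zeros zero    = refl
weight-zeros (suc n) = weight-zeros n

weight-ones : ∀ n → weight (ones n) ≡ n
weight-ones zero    = refl
weight-ones (suc n) = cong suc (weight-ones n)

·-zerosˡ : ∀ {n} (x : Vtx n) → zeros n · x ≡ false
·-zerosˡ []      = refl
·-zerosˡ (a ∷ x) = ·-zerosˡ x

·-zerosʳ : ∀ {n} (s : Vtx n) → s · zeros n ≡ false
·-zerosʳ []          = refl
·-zerosʳ (false ∷ s) = ·-zerosʳ s
·-zerosʳ (true ∷ s)  = ·-zerosʳ s

when-* : ∀ c b → c when b ≡ c * (1 when b)
when-* c true  = sym (*-identityʳ c)
when-* c false = sym (*-zeroʳ c)

when-∨ : ∀ c p q → (T p → T q → ⊥) → c when (p ∨ q) ≡ c when p + c when q
when-∨ c true  true  p⊥q = ⊥-elim (p⊥q _ _)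
when-∨ c true  false _   = sym (+-identityʳ c)
when-∨ c false q     _   = refl

when-+-when-not : ∀ c b → c when b + c when not b ≡ c
when-+-when-not c true  = +-identityʳ c
when-+-when-not c false = refl

∑-const : ∀ n c → ∑ {n} (λ _ → c) ≡ 2 ^ n * c
∑-const zero    c = sym (+-identityʳ c)
∑-const (suc n) c = trans (cong₂ _+_ (∑-const n c) (∑-const n c)) (double (2 ^ n) c)
  where
  double : ∀ a c → a * c + a * c ≡ (2 * a) * c
  double = solve-∀

∑-ones : ∀ n → ∑ {n} (λ _ → 1) ≡ 2 ^ n
∑-ones n = trans (∑-const n 1) (*-identityʳ (2 ^ n))

∑-mono : ∀ {n} {h k : Vtx n → ℕ} → (∀ x → h x ≤ k x) → ∑ h ≤ ∑ k
∑-mono {zero}  h≤k = h≤k []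
∑-mono {suc n} h≤k = +-mono-≤ (∑-mono (h≤k ∘ (false ∷_))) (∑-mono (h≤k ∘ (true ∷_)))

∑-point : ∀ {n} (z : Vtx n) (h : Vtx n → ℕ) → ∑ (λ y → h y when does (y ≟ᵛ z)) ≡ h z
∑-point         []          h = refl
∑-point {suc n} (false ∷ z) h = trans (cong₂ _+_ (∑-point z (h ∘ (false ∷_))) (∑-zero n)) (+-identityʳ _)
∑-point {suc n} (true ∷ z)  h = cong₂ _+_ (∑-zero n) (∑-point z (h ∘ (true ∷_)))

count≡0⊎∃ : ∀ {n} (P : Vtx n → Bool) → count P ≡ 0 ⊎ ∃ (T ∘ P)
count≡0⊎∃ {zero} P with P [] in P[]≡b
... | true  = inj₂ ([] , subst T (sym P[]≡b) _)
... | false = inj₁ refl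
count≡0⊎∃ {suc n} P with count≡0⊎∃ (P ∘ (false ∷_)) | count≡0⊎∃ (P ∘ (true ∷_))
... | inj₂ (x , Px) | _             = inj₂ (false ∷ x , Px)
... | inj₁ _        | inj₂ (x , Px) = inj₂ (true ∷ x , Px)
... | inj₁ c₀≡0     | inj₁ c₁≡0     = inj₁ (cong₂ _+_ c₀≡0 c₁≡0)

count≤1 : ∀ {n} (P : Vtx n → Bool) → (∀ {x y} → T (P x) → T (P y) → x ≡ y) → count P ≤ 1
count≤1 {zero} P _ with P []
... | true  = s≤s z≤n
... | false = z≤n
count≤1 {suc n} P unique with count≡0⊎∃ (P ∘ (false ∷_)) | count≡0⊎∃ (P ∘ (true ∷_))
... | inj₁ c₀≡0 | _ rewrite c₀≡0 =
  count≤1 (P ∘ (true ∷_)) λ Px Py → ∷-injectiveʳ (unique Px Py)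
... | inj₂ _ | inj₁ c₁≡0 rewrite c₁≡0 | +-identityʳ (count (P ∘ (false ∷_))) =
  count≤1 (P ∘ (false ∷_)) λ Px Py → ∷-injectiveʳ (unique Px Py)
... | inj₂ (x , Px) | inj₂ (y , Py) with unique {false ∷ x} {true ∷ y} Px Py
... | ()

+-mono-≤-≡⇒≡ : ∀ {a b c d} → a ≤ b → c ≤ d → a + c ≡ b + d → a ≡ b × c ≡ d
+-mono-≤-≡⇒≡ {a} {b} {c} {d} a≤b c≤d a+c≡b+d =
  ≤-antisym a≤b (+-cancelʳ-≤ c b a (≤-trans (+-monoʳ-≤ b c≤d) (≤-reflexive (sym a+c≡b+d)))) ,
  ≤-antisym c≤d (+-cancelˡ-≤ a d c (≤-trans (+-monoˡ-≤ d a≤b) (≤-reflexive (sym a+c≡b+d))))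

∑-≤-≡⇒≗ : ∀ {n} {h k : Vtx n → ℕ} → (∀ x → h x ≤ k x) → ∑ h ≡ ∑ k → ∀ x → h x ≡ k x
∑-≤-≡⇒≗ {zero}  _   ∑h≡∑k []      = ∑h≡∑k
∑-≤-≡⇒≗ {suc n} h≤k ∑h≡∑k (b ∷ x)
  with +-mono-≤-≡⇒≡ (∑-mono (h≤k ∘ (false ∷_))) (∑-mono (h≤k ∘ (true ∷_))) ∑h≡∑k
∑-≤-≡⇒≗ {suc n} h≤k _ (false ∷ x) | ∑₀ , _ = ∑-≤-≡⇒≗ (h≤k ∘ (false ∷_)) ∑₀ x
∑-≤-≡⇒≗ {suc n} h≤k _ (true ∷ x)  | _ , ∑₁ = ∑-≤-≡⇒≗ (h≤k ∘ (true ∷_)) ∑₁ x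

∑-reindex : ∀ {n} {f : Vtx n → Vtx n} → Injective _≡_ _≡_ f → (h : Vtx n → ℕ) → ∑ (h ∘ f) ≡ ∑ h
∑-reindex {n} {f} f-inj h = begin
  ∑ (h ∘ f)                                    ≡⟨ ∑-cong (λ x → ∑-point (f x) h) ⟨
  ∑ (λ x → ∑ λ y → h y when hits y x)          ≡⟨ ∑-comm (λ x y → h y when hits y x) ⟩
  ∑ (λ y → ∑ λ x → h y when hits y x)          ≡⟨ ∑-cong (λ y → ∑-cong λ x → when-* (h y) (hits y x)) ⟩
  ∑ (λ y → ∑ λ x → h y * (1 when hits y x))    ≡⟨ ∑-cong (λ y → *-distribˡ-∑ (h y) λ x → 1 when hits y x) ⟨
  ∑ (λ y → h y * fibre y)                      ≡⟨ ∑-cong (λ y → trans (cong (h y *_) (fibre≡1 y)) (*-identityʳ (h y))) ⟩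
  ∑ h                                          ∎
  where
  open ≡-Reasoning
  hits : Vtx n → Vtx n → Bool
  hits y x = does (y ≟ᵛ f x)
  fibre : Vtx n → ℕ
  fibre y = count (hits y)
  fibre≤1 : ∀ y → fibre y ≤ 1
  fibre≤1 y = count≤1 (hits y) λ p q → f-inj (trans (sym (≟ᵛ⇒≡ {x = y} p)) (≟ᵛ⇒≡ {x = y} q))
  ∑fibre : ∑ fibre ≡ ∑ {n} (λ _ → 1)
  ∑fibre = trans (∑-comm (λ y x → 1 when hits y x)) (∑-cong λ x → ∑-point (f x) (λ _ → 1))
  fibre≡1 : ∀ y → fibre y ≡ 1
  fibre≡1 = ∑-≤-≡⇒≗ fibre≤1 ∑fibre

hamming-refl : ∀ {n} (x : Vtx n) → hamming x x ≡ 0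
hamming-refl []          = refl
hamming-refl (false ∷ x) = hamming-refl x
hamming-refl (true ∷ x)  = hamming-refl x

hamming-sym : ∀ {n} (x y : Vtx n) → hamming x y ≡ hamming y x
hamming-sym []          []          = refl
hamming-sym (false ∷ x) (false ∷ y) = hamming-sym x y
hamming-sym (false ∷ x) (true ∷ y)  = cong suc (hamming-sym x y)
hamming-sym (true ∷ x)  (false ∷ y) = cong suc (hamming-sym x y)
hamming-sym (true ∷ x)  (true ∷ y)  = hamming-sym x y

bitDist-triangle : ∀ a b c → bitDist a c ≤ bitDist a b + bitDist b c
bitDist-triangle false false c     = ≤-refl
bitDist-triangle false true  false = z≤n
bitDist-triangle false true  true  = s≤s z≤n
bitDist-triangle true  false false = s≤s z≤n
bitDist-triangle true  false true  = z≤n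
bitDist-triangle true  true  c     = ≤-refl

hamming-triangle : ∀ {n} (x y z : Vtx n) → hamming x z ≤ hamming x y + hamming y z
hamming-triangle []      []      []      = z≤n
hamming-triangle (a ∷ x) (b ∷ y) (c ∷ z) = begin
  bitDist a c + hamming x z                                 ≤⟨ +-mono-≤ (bitDist-triangle a b c) (hamming-triangle x y z) ⟩
  (bitDist a b + bitDist b c) + (hamming x y + hamming y z) ≡⟨ +-interchange (bitDist a b) _ _ _ ⟩
  (bitDist a b + hamming x y) + (bitDist b c + hamming y z) ∎
  where open ≤-Reasoning

hamming-lookup-tail : ∀ {n} (u v : Vtx (suc n)) →
                      hamming u v ≡ bitDist (lookup u zero) (lookup v zero) + hamming (tail u) (tail v)
hamming-lookup-tail (a ∷ u) (b ∷ v) = refl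

hamming-⊕ : ∀ {n} (x a : Vtx n) → hamming x (x ⊕ a) ≡ weight a
hamming-⊕ []          []          = refl
hamming-⊕ (false ∷ x) (false ∷ a) = hamming-⊕ x a
hamming-⊕ (false ∷ x) (true ∷ a)  = cong suc (hamming-⊕ x a)
hamming-⊕ (true ∷ x)  (false ∷ a) = hamming-⊕ x a
hamming-⊕ (true ∷ x)  (true ∷ a)  = cong suc (hamming-⊕ x a)

hamming-complement : ∀ {n} (x : Vtx n) → hamming x (complement x) ≡ n
hamming-complement {n} x =
  trans (cong (hamming x) (complement≡⊕ones x)) (trans (hamming-⊕ x (ones n)) (weight-ones n))

hamming≡ᵇ0 : ∀ {n} (x y : Vtx n) → (hamming x y ≡ᵇ 0) ≡ does (y ≟ᵛ x)
hamming≡ᵇ0 []          []          = refl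
hamming≡ᵇ0 (false ∷ x) (false ∷ y) = hamming≡ᵇ0 x y
hamming≡ᵇ0 (false ∷ x) (true ∷ y)  = refl
hamming≡ᵇ0 (true ∷ x)  (false ∷ y) = refl
hamming≡ᵇ0 (true ∷ x)  (true ∷ y)  = hamming≡ᵇ0 x y

-- Arcs and edges of FQₙ

arcSum : ∀ {n} → (Vtx n → Vtx n → ℕ) → ℕ
arcSum c = ∑ λ x → ∑ₛ λ a → c x (x ⊕ a)

edgeSum : ∀ {n} → (Vtx n → Vtx n → ℕ) → ℕ
edgeSum c = ∑ λ x → ∑ λ y → c x y when (lexLtᵇ x y ∧ fqAdjᵇ x y)

arcSum-distrib-+ : ∀ {n} (c d : Vtx n → Vtx n → ℕ) → arcSum (λ x y → c x y + d x y) ≡ arcSum c + arcSum d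
arcSum-distrib-+ c d =
  trans (∑-cong λ x → ∑ₛ-distrib-+ (λ a → c x (x ⊕ a)) (λ a → d x (x ⊕ a)))
        (∑-distrib-+ (λ x → ∑ₛ λ a → c x (x ⊕ a)) (λ x → ∑ₛ λ a → d x (x ⊕ a)))

∑-hamming≡ᵇ0 : ∀ {n} (x : Vtx n) (h : Vtx n → ℕ) → ∑ (λ y → h y when (hamming x y ≡ᵇ 0)) ≡ h x
∑-hamming≡ᵇ0 x h = trans (∑-cong λ y → cong (h y when_) (hamming≡ᵇ0 x y)) (∑-point x h)

∑-qAdj : ∀ {n} (x : Vtx n) (h : Vtx n → ℕ) → ∑ (λ y → h y when qAdjᵇ x y) ≡ ∑ₑ (λ a → h (x ⊕ a))
∑-qAdj []          h = refl
∑-qAdj (false ∷ x) h = begin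
  ∑ (λ y → h (false ∷ y) when qAdjᵇ x y) + ∑ (λ y → h (true ∷ y) when (hamming x y ≡ᵇ 0))
    ≡⟨ cong₂ _+_ (∑-qAdj x (h ∘ (false ∷_))) (∑-hamming≡ᵇ0 x (h ∘ (true ∷_))) ⟩
  ∑ₑ (λ a → h (false ∷ x ⊕ a)) + h (true ∷ x)
    ≡⟨ +-comm (∑ₑ λ a → h (false ∷ x ⊕ a)) (h (true ∷ x)) ⟩
  h (true ∷ x) + ∑ₑ (λ a → h (false ∷ x ⊕ a))
    ≡⟨ cong (λ z → h (true ∷ z) + ∑ₑ λ a → h (false ∷ x ⊕ a)) (⊕-identityʳ x) ⟨
  h (true ∷ x ⊕ zeros _) + ∑ₑ (λ a → h (false ∷ x ⊕ a)) ∎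
  where open ≡-Reasoning
∑-qAdj (true ∷ x)  h = cong₂ _+_
  (trans (∑-hamming≡ᵇ0 x (h ∘ (false ∷_))) (cong (λ z → h (false ∷ z)) (sym (⊕-identityʳ x))))
  (∑-qAdj x (h ∘ (true ∷_)))

∑-fqAdj : ∀ {n} (x : Vtx (2 + n)) (h : Vtx (2 + n) → ℕ) →
          ∑ (λ y → h y when fqAdjᵇ x y) ≡ ∑ₛ (λ a → h (x ⊕ a))
∑-fqAdj {n} x h = begin
  ∑ (λ y → h y when fqAdjᵇ x y)
    ≡⟨ ∑-cong (λ y → when-∨ (h y) _ _ (antipode-not-adjacent y)) ⟩
  ∑ (λ y → h y when qAdjᵇ x y + h y when antipode y)
    ≡⟨ ∑-distrib-+ (λ y → h y when qAdjᵇ x y) (λ y → h y when antipode y) ⟩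
  ∑ (λ y → h y when qAdjᵇ x y) + ∑ (λ y → h y when antipode y)
    ≡⟨ cong₂ _+_ (∑-qAdj x h) (∑-point (complement x) h) ⟩
  ∑ₑ (λ a → h (x ⊕ a)) + h (complement x)
    ≡⟨ cong (λ z → ∑ₑ (λ a → h (x ⊕ a)) + h z) (complement≡⊕ones x) ⟩
  ∑ₛ (λ a → h (x ⊕ a)) ∎
  where
  open ≡-Reasoning
  antipode : Vtx (2 + n) → Bool
  antipode y = does (y ≟ᵛ complement x)
  antipode-not-adjacent : ∀ y → T (qAdjᵇ x y) → T (antipode y) → ⊥
  antipode-not-adjacent y adj y≡x̄ rewrite ≟ᵛ⇒≡ {x = y} y≡x̄ | hamming-complement x = adj

lexLtᵇ-flip : ∀ {n} {x y : Vtx n} → x ≢ y → lexLtᵇ y x ≡ not (lexLtᵇ x y)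
lexLtᵇ-flip {x = []}        {[]}        x≢y = ⊥-elim (x≢y refl)
lexLtᵇ-flip {x = false ∷ x} {false ∷ y} x≢y = lexLtᵇ-flip (x≢y ∘ cong (false ∷_))
lexLtᵇ-flip {x = false ∷ x} {true ∷ y}  _   = refl
lexLtᵇ-flip {x = true ∷ x}  {false ∷ y} _   = refl
lexLtᵇ-flip {x = true ∷ x}  {true ∷ y}  x≢y = lexLtᵇ-flip (x≢y ∘ cong (true ∷_))

≟-complement-sym : ∀ {n} (x y : Vtx n) → does (y ≟ᵛ complement x) ≡ does (x ≟ᵛ complement y)
≟-complement-sym []          []          = refl
≟-complement-sym (false ∷ x) (false ∷ y) = refl
≟-complement-sym (false ∷ x) (true ∷ y)  = ≟-complement-sym x y
≟-complement-sym (true ∷ x)  (false ∷ y) = ≟-complement-sym x y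
≟-complement-sym (true ∷ x)  (true ∷ y)  = refl

fqAdjᵇ-sym : ∀ {n} (x y : Vtx n) → fqAdjᵇ x y ≡ fqAdjᵇ y x
fqAdjᵇ-sym x y = cong₂ _∨_ (cong (_≡ᵇ 1) (hamming-sym x y)) (≟-complement-sym x y)

fqAdjᵇ-irrefl : ∀ {n} (x : Vtx (suc n)) → fqAdjᵇ x x ≡ false
fqAdjᵇ-irrefl (false ∷ x) rewrite hamming-refl x = refl
fqAdjᵇ-irrefl (true ∷ x)  rewrite hamming-refl x = refl

fqAdjᵇ⇒≢ : ∀ {n} {x y : Vtx (suc n)} → fqAdjᵇ x y ≡ true → x ≢ y
fqAdjᵇ⇒≢ {x = x} adj refl = case trans (sym adj) (fqAdjᵇ-irrefl x) of λ ()

when-edge-pair : ∀ {n} (x y : Vtx (suc n)) c →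
                 c when (lexLtᵇ x y ∧ fqAdjᵇ x y) + c when (lexLtᵇ y x ∧ fqAdjᵇ y x) ≡ c when fqAdjᵇ x y
when-edge-pair x y c rewrite fqAdjᵇ-sym y x with fqAdjᵇ x y in adj
... | false = cong₂ (λ p q → c when p + c when q) (∧-zeroʳ (lexLtᵇ x y)) (∧-zeroʳ (lexLtᵇ y x))
... | true  = begin
  c when (lexLtᵇ x y ∧ true) + c when (lexLtᵇ y x ∧ true) ≡⟨ cong₂ (λ p q → c when p + c when q) x<y y<x ⟩
  c when lexLtᵇ x y + c when not (lexLtᵇ x y)             ≡⟨ when-+-when-not c (lexLtᵇ x y) ⟩
  c                                                       ∎
  where
  open ≡-Reasoning
  x<y : lexLtᵇ x y ∧ true ≡ lexLtᵇ x y
  x<y = ∧-identityʳ (lexLtᵇ x y)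
  y<x : lexLtᵇ y x ∧ true ≡ not (lexLtᵇ x y)
  y<x = trans (∧-identityʳ (lexLtᵇ y x)) (lexLtᵇ-flip (fqAdjᵇ⇒≢ {x = x} {y} adj))

arcSum≡2*edgeSum : ∀ {n} (c : Vtx (2 + n) → Vtx (2 + n) → ℕ) → (∀ x y → c x y ≡ c y x) →
                   arcSum c ≡ 2 * edgeSum c
arcSum≡2*edgeSum {n} c c-sym = begin
  arcSum c                                     ≡⟨ ∑-cong (λ x → ∑-fqAdj x (c x)) ⟨
  ∑ (λ x → ∑ λ y → c x y when fqAdjᵇ x y)      ≡⟨ ∑-cong (λ x → ∑-cong λ y → when-edge-pair x y (c x y)) ⟨
  ∑ (λ x → ∑ λ y → forward x y + backward x y) ≡⟨ ∑-cong (λ x → ∑-distrib-+ (forward x) (backward x)) ⟩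
  ∑ (λ x → ∑ (forward x) + ∑ (backward x))     ≡⟨ ∑-distrib-+ (λ x → ∑ (forward x)) (λ x → ∑ (backward x)) ⟩
  edgeSum c + ∑ (λ x → ∑ (backward x))         ≡⟨ cong (edgeSum c +_) (∑-comm backward) ⟩
  edgeSum c + ∑ (λ y → ∑ λ x → backward x y)   ≡⟨ cong (edgeSum c +_) (∑-cong λ y → ∑-cong (backward≡forward y)) ⟩
  edgeSum c + edgeSum c                        ≡⟨ cong (edgeSum c +_) (+-identityʳ (edgeSum c)) ⟨
  2 * edgeSum c                                ∎
  where
  open ≡-Reasoning
  forward backward : Vtx (2 + n) → Vtx (2 + n) → ℕ
  forward  x y = c x y when (lexLtᵇ x y ∧ fqAdjᵇ x y)
  backward x y = c x y when (lexLtᵇ y x ∧ fqAdjᵇ y x)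
  backward≡forward : ∀ y x → backward x y ≡ forward y x
  backward≡forward y x = cong (_when (lexLtᵇ y x ∧ fqAdjᵇ y x)) (c-sym x y)

sum-allVtx : ∀ n (h : Vtx n → ℕ) → sum (List.map h (allVtx n)) ≡ ∑ h
sum-allVtx zero    h = +-identityʳ (h [])
sum-allVtx (suc n) h = begin
  sum (List.map h (List.map (false ∷_) A ++ List.map (true ∷_) A))
    ≡⟨ cong sum (map-++ h (List.map (false ∷_) A) (List.map (true ∷_) A)) ⟩
  sum (List.map h (List.map (false ∷_) A) ++ List.map h (List.map (true ∷_) A))
    ≡⟨ sum-++ (List.map h (List.map (false ∷_) A)) (List.map h (List.map (true ∷_) A)) ⟩
  sum (List.map h (List.map (false ∷_) A)) + sum (List.map h (List.map (true ∷_) A))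
    ≡⟨ cong₂ _+_ (cong sum (map-∘ A)) (cong sum (map-∘ A)) ⟨
  sum (List.map (h ∘ (false ∷_)) A) + sum (List.map (h ∘ (true ∷_)) A)
    ≡⟨ cong₂ _+_ (sum-allVtx n (h ∘ (false ∷_))) (sum-allVtx n (h ∘ (true ∷_))) ⟩
  ∑ h ∎
  where
  open ≡-Reasoning
  A : List (Vtx n)
  A = allVtx n

sum-cartesianProductWith : ∀ {A B : Set} (g : A → B → ℕ) (xs : List A) (ys : List B) →
  sum (cartesianProductWith g xs ys) ≡ sum (List.map (λ x → sum (List.map (g x) ys)) xs)
sum-cartesianProductWith g List.[]       ys = refl
sum-cartesianProductWith g (x List.∷ xs) ys =
  trans (sum-++ (List.map (g x) ys) (cartesianProductWith g xs ys))
        (cong (sum (List.map (g x) ys) +_) (sum-cartesianProductWith g xs ys))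

wirelength≡∑ : ∀ {n} (E : Embedding n) →
               wirelength E ≡ ∑ λ x → ∑ λ y → edgeCost E x y (T? (lexLtᵇ x y ∧ fqAdjᵇ x y))
wirelength≡∑ {n} E =
  trans (sum-cartesianProductWith cost (allVtx n) (allVtx n))
        (trans (cong sum (map-cong (λ x → sum-allVtx n (cost x)) (allVtx n))) (sum-allVtx n _))
  where
  cost : Vtx n → Vtx n → ℕ
  cost x y = edgeCost E x y (T? (lexLtᵇ x y ∧ fqAdjᵇ x y))

walkLength≥hamming : ∀ {n} {x y : Vtx n} (w : Walk x y) → hamming x y ≤ walkLength w
walkLength≥hamming (nil x)                     = ≤-reflexive (hamming-refl x)
walkLength≥hamming (cons {x = x} {y} {z} adj w) = begin
  hamming x z               ≤⟨ hamming-triangle x y z ⟩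
  hamming x y + hamming y z ≡⟨ cong (_+ hamming y z) (≡ᵇ⇒≡ (hamming x y) 1 adj) ⟩
  suc (hamming y z)         ≤⟨ s≤s (walkLength≥hamming w) ⟩
  suc (walkLength w)        ∎
  where open ≤-Reasoning

edgeSum≤wirelength : ∀ {n} (E : Embedding n) →
                     edgeSum (λ x y → hamming (Embedding.f E x) (Embedding.f E y)) ≤ wirelength E
edgeSum≤wirelength {n} E = ≤-trans (∑-mono λ x → ∑-mono λ y → cost x y (T? (lexLtᵇ x y ∧ fqAdjᵇ x y)))
                                   (≤-reflexive (sym (wirelength≡∑ E)))
  where
  open Embedding E
  cost : ∀ x y (d : Dec (FQEdge x y)) → hamming (f x) (f y) when does d ≤ edgeCost E x y d
  cost x y (yes e) = walkLength≥hamming (proj₁ (P x y e))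
  cost x y (no _)  = z≤n

prepend : ∀ {n} b {x y : Vtx n} → Walk x y → Walk (b ∷ x) (b ∷ y)
prepend b     (nil x)      = nil (b ∷ x)
prepend false (cons adj w) = cons adj (prepend false w)
prepend true  (cons adj w) = cons adj (prepend true w)

walkVertices-prepend : ∀ {n} b {x y : Vtx n} (w : Walk x y) →
                       walkVertices (prepend b w) ≡ List.map (b ∷_) (walkVertices w)
walkVertices-prepend b     (nil x)      = refl
walkVertices-prepend false (cons adj w) = cong (_ List.∷_) (walkVertices-prepend false w)
walkVertices-prepend true  (cons adj w) = cong (_ List.∷_) (walkVertices-prepend true w)

walkLength-prepend : ∀ {n} b {x y : Vtx n} (w : Walk x y) → walkLength (prepend b w) ≡ walkLength w
walkLength-prepend b     (nil x)      = refl
walkLength-prepend false (cons adj w) = cong suc (walkLength-prepend false w)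
walkLength-prepend true  (cons adj w) = cong suc (walkLength-prepend true w)

prependPath : ∀ {n} b {x y : Vtx n} → QPath x y → QPath (b ∷ x) (b ∷ y)
prependPath b (w , unique) =
  prepend b w , subst Unique (sym (walkVertices-prepend b w)) (Unique-map⁺ ∷-injectiveʳ unique)

flip-adjacent : ∀ {n} b (x : Vtx n) → QAdj (b ∷ x) (not b ∷ x)
flip-adjacent false x = subst (λ k → T (k ≡ᵇ 0)) (sym (hamming-refl x)) _
flip-adjacent true  x = subst (λ k → T (k ≡ᵇ 0)) (sym (hamming-refl x)) _

flipPath : ∀ {n} b {x y : Vtx n} → QPath x y → QPath (b ∷ x) (not b ∷ y)
flipPath b {x} p@(w , _) = cons (flip-adjacent b x) (prepend (not b) w) , fresh ∷ proj₂ (prependPath (not b) p)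
  where
  fresh : All (λ v → ¬ (b ∷ x ≡ v)) (walkVertices (prepend (not b) w))
  fresh = subst (All _) (sym (walkVertices-prepend (not b) w))
                (All-map⁺ (universal (λ v eq → not-¬ refl (∷-injectiveˡ eq)) (walkVertices w)))

geodesic : ∀ {n} (x y : Vtx n) → QPath x y
geodesic []          []          = nil [] , [] ∷ []
geodesic (false ∷ x) (false ∷ y) = prependPath false (geodesic x y)
geodesic (true ∷ x)  (true ∷ y)  = prependPath true (geodesic x y)
geodesic (false ∷ x) (true ∷ y)  = flipPath false (geodesic x y)
geodesic (true ∷ x)  (false ∷ y) = flipPath true (geodesic x y)

pathLength-geodesic : ∀ {n} (x y : Vtx n) → pathLength (geodesic x y) ≡ hamming x y
pathLength-geodesic []          []          = refl
pathLength-geodesic (false ∷ x) (false ∷ y) = trans (walkLength-prepend false _) (pathLength-geodesic x y)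
pathLength-geodesic (true ∷ x)  (true ∷ y)  = trans (walkLength-prepend true _) (pathLength-geodesic x y)
pathLength-geodesic (false ∷ x) (true ∷ y)  = cong suc (trans (walkLength-prepend true _) (pathLength-geodesic x y))
pathLength-geodesic (true ∷ x)  (false ∷ y) = cong suc (trans (walkLength-prepend false _) (pathLength-geodesic x y))

geodesicEmbedding : ∀ n → Embedding n
geodesicEmbedding n = record { f = id ; f-inj = id ; P = λ x y _ → geodesic x y }

wirelength-geodesicEmbedding≡edgeSum : ∀ n → wirelength (geodesicEmbedding n) ≡ edgeSum {n} hamming
wirelength-geodesicEmbedding≡edgeSum n = trans (wirelength≡∑ (geodesicEmbedding n))
  (∑-cong λ x → ∑-cong λ y → cost x y (T? (lexLtᵇ x y ∧ fqAdjᵇ x y)))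
  where
  cost : ∀ x y (d : Dec (FQEdge x y)) → edgeCost (geodesicEmbedding n) x y d ≡ hamming x y when does d
  cost x y (yes _) = pathLength-geodesic x y
  cost x y (no _)  = refl

∑ₑ-weight : ∀ n → ∑ₑ {n} weight ≡ n
∑ₑ-weight zero    = refl
∑ₑ-weight (suc n) = cong₂ (λ a b → suc (a + b)) (weight-zeros n) (∑ₑ-weight n)

arcSum-hamming : ∀ n → arcSum {n} hamming ≡ 2 ^ n * (n + n)
arcSum-hamming n = trans (∑-cong λ x → cong₂ _+_ (trans (∑ₑ-cong (hamming-⊕ x)) (∑ₑ-weight n))
                                                   (trans (hamming-⊕ x (ones n)) (weight-ones n)))
                         (∑-const n (n + n))

wirelength-geodesicEmbedding : ∀ m → wirelength (geodesicEmbedding (2 + m)) ≡ (2 + m) * 2 ^ (2 + m)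
wirelength-geodesicEmbedding m = *-cancelˡ-≡ _ _ 2 (begin
  2 * wirelength (geodesicEmbedding n) ≡⟨ cong (2 *_) (wirelength-geodesicEmbedding≡edgeSum n) ⟩
  2 * edgeSum {n} hamming              ≡⟨ arcSum≡2*edgeSum {m} hamming hamming-sym ⟨
  arcSum {n} hamming                   ≡⟨ arcSum-hamming n ⟩
  2 ^ n * (n + n)                      ≡⟨ rearrange (2 ^ n) n ⟩
  2 * (n * 2 ^ n)                      ∎)
  where
  open ≡-Reasoning
  n : ℕ
  n = 2 + m
  rearrange : ∀ p n → p * (n + n) ≡ 2 * (n * p)
  rearrange = solve-∀

-- The Walsh transform

∑ᶻ-+ : ∀ {n} (h : Vtx n → ℕ) → ∑ᶻ (λ x → ℤ.+ h x) ≡ ℤ.+ ∑ h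
∑ᶻ-+ {zero}  h = refl
∑ᶻ-+ {suc n} h = trans (cong₂ ℤ._+_ (∑ᶻ-+ (h ∘ (false ∷_))) (∑ᶻ-+ (h ∘ (true ∷_))))
                       (sym (ℤ.pos-+ (∑ (h ∘ (false ∷_))) (∑ (h ∘ (true ∷_)))))

χ : Bool → ℤ
χ false = 1ℤ
χ true  = -1ℤ

χ-not : ∀ p → χ (not p) ≡ ℤ.- χ p
χ-not false = refl
χ-not true  = refl

-- The butterfly recursion for walsh h s = Σₓ (-1)^(s·x) h x.
walsh : ∀ {n} → (Vtx n → ℤ) → Vtx n → ℤ
walsh {zero}  h []      = h []
walsh {suc n} h (b ∷ s) = walsh (h ∘ (false ∷_)) s ℤ.+ χ b ℤ.* walsh (h ∘ (true ∷_)) s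

walsh-zeros : ∀ {n} (h : Vtx n → ℤ) → walsh h (zeros n) ≡ ∑ᶻ h
walsh-zeros {zero}  h = refl
walsh-zeros {suc n} h =
  cong₂ ℤ._+_ (walsh-zeros (h ∘ (false ∷_))) (trans (ℤ.*-identityˡ _) (walsh-zeros (h ∘ (true ∷_))))

walsh-sub : ∀ {n} (h k : Vtx n → ℤ) s → walsh (λ x → h x - k x) s ≡ walsh h s - walsh k s
walsh-sub {zero}  h k []      = refl
walsh-sub {suc n} h k (b ∷ s) =
  trans (cong₂ (λ u v → u ℤ.+ χ b ℤ.* v) (walsh-sub h₀ k₀ s) (walsh-sub h₁ k₁ s))
        (regroup (χ b) (walsh h₀ s) (walsh k₀ s) (walsh h₁ s) (walsh k₁ s))
  where
  h₀ h₁ k₀ k₁ : Vtx n → ℤ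
  h₀ = h ∘ (false ∷_)
  h₁ = h ∘ (true ∷_)
  k₀ = k ∘ (false ∷_)
  k₁ = k ∘ (true ∷_)
  regroup : ∀ β p q u v → (p - q) ℤ.+ β ℤ.* (u - v) ≡ (p ℤ.+ β ℤ.* u) - (q ℤ.+ β ℤ.* v)
  regroup = ℤ-Solver.solve-∀

walsh-translate : ∀ {n} (a : Vtx n) (h : Vtx n → ℤ) s → walsh (λ x → h (x ⊕ a)) s ≡ χ (s · a) ℤ.* walsh h s
walsh-translate {zero}  []          h []          = sym (ℤ.*-identityˡ (h []))
walsh-translate {suc n} (false ∷ a) h (b ∷ s)     = begin
  walsh (λ x → h₀ (x ⊕ a)) s ℤ.+ χ b ℤ.* walsh (λ x → h₁ (x ⊕ a)) s
    ≡⟨ cong₂ (λ u v → u ℤ.+ χ b ℤ.* v) (walsh-translate a h₀ s) (walsh-translate a h₁ s) ⟩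
  χ (s · a) ℤ.* walsh h₀ s ℤ.+ χ b ℤ.* (χ (s · a) ℤ.* walsh h₁ s)
    ≡⟨ factor (χ (s · a)) (χ b) (walsh h₀ s) (walsh h₁ s) ⟩
  χ (s · a) ℤ.* (walsh h₀ s ℤ.+ χ b ℤ.* walsh h₁ s)
    ≡⟨ cong (λ p → χ (p xor (s · a)) ℤ.* (walsh h₀ s ℤ.+ χ b ℤ.* walsh h₁ s)) (∧-zeroʳ b) ⟨
  χ ((b ∧ false) xor (s · a)) ℤ.* (walsh h₀ s ℤ.+ χ b ℤ.* walsh h₁ s) ∎
  where
  open ≡-Reasoning
  h₀ h₁ : Vtx n → ℤ
  h₀ = h ∘ (false ∷_)
  h₁ = h ∘ (true ∷_)
  factor : ∀ e β u v → e ℤ.* u ℤ.+ β ℤ.* (e ℤ.* v) ≡ e ℤ.* (u ℤ.+ β ℤ.* v)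
  factor = ℤ-Solver.solve-∀
walsh-translate {suc n} (true ∷ a)  h (false ∷ s) =
  trans (cong₂ (λ u v → u ℤ.+ 1ℤ ℤ.* v) (walsh-translate a h₁ s) (walsh-translate a h₀ s))
        (swap (χ (s · a)) (walsh h₀ s) (walsh h₁ s))
  where
  h₀ h₁ : Vtx n → ℤ
  h₀ = h ∘ (false ∷_)
  h₁ = h ∘ (true ∷_)
  swap : ∀ e u v → e ℤ.* v ℤ.+ 1ℤ ℤ.* (e ℤ.* u) ≡ e ℤ.* (u ℤ.+ 1ℤ ℤ.* v)
  swap = ℤ-Solver.solve-∀
walsh-translate {suc n} (true ∷ a)  h (true ∷ s)  =
  trans (cong₂ (λ u v → u ℤ.+ -1ℤ ℤ.* v) (walsh-translate a h₁ s) (walsh-translate a h₀ s))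
        (trans (swap (χ (s · a)) (walsh h₀ s) (walsh h₁ s))
               (cong (ℤ._* (walsh h₀ s ℤ.+ -1ℤ ℤ.* walsh h₁ s)) (sym (χ-not (s · a)))))
  where
  h₀ h₁ : Vtx n → ℤ
  h₀ = h ∘ (false ∷_)
  h₁ = h ∘ (true ∷_)
  swap : ∀ e u v → e ℤ.* v ℤ.+ -1ℤ ℤ.* (e ℤ.* u) ≡ ℤ.- e ℤ.* (u ℤ.+ -1ℤ ℤ.* v)
  swap = ℤ-Solver.solve-∀

parseval : ∀ {n} (h : Vtx n → ℤ) → ∑ᶻ (λ s → walsh h s ℤ.* walsh h s) ≡ ℤ.+ (2 ^ n) ℤ.* ∑ᶻ (λ x → h x ℤ.* h x)
parseval {zero}  h = sym (ℤ.*-identityˡ _)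
parseval {suc n} h = begin
  ∑ᶻ (λ s → square (U s ℤ.+ 1ℤ ℤ.* V s)) ℤ.+ ∑ᶻ (λ s → square (U s ℤ.+ -1ℤ ℤ.* V s))
    ≡⟨ ∑ᶻ-distrib-+ (λ s → square (U s ℤ.+ 1ℤ ℤ.* V s)) (λ s → square (U s ℤ.+ -1ℤ ℤ.* V s)) ⟨
  ∑ᶻ (λ s → square (U s ℤ.+ 1ℤ ℤ.* V s) ℤ.+ square (U s ℤ.+ -1ℤ ℤ.* V s))
    ≡⟨ ∑ᶻ-cong (λ s → parallelogram (U s) (V s)) ⟩
  ∑ᶻ (λ s → ℤ.+ 2 ℤ.* (square (U s) ℤ.+ square (V s)))
    ≡⟨ *-distribˡ-∑ᶻ (ℤ.+ 2) (λ s → square (U s) ℤ.+ square (V s)) ⟨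
  ℤ.+ 2 ℤ.* ∑ᶻ (λ s → square (U s) ℤ.+ square (V s))
    ≡⟨ cong (ℤ.+ 2 ℤ.*_) (∑ᶻ-distrib-+ (square ∘ U) (square ∘ V)) ⟩
  ℤ.+ 2 ℤ.* (∑ᶻ (square ∘ U) ℤ.+ ∑ᶻ (square ∘ V))
    ≡⟨ cong (ℤ.+ 2 ℤ.*_) (cong₂ ℤ._+_ (parseval h₀) (parseval h₁)) ⟩
  ℤ.+ 2 ℤ.* (ℤ.+ (2 ^ n) ℤ.* ∑ᶻ (square ∘ h₀) ℤ.+ ℤ.+ (2 ^ n) ℤ.* ∑ᶻ (square ∘ h₁))
    ≡⟨ factor (ℤ.+ (2 ^ n)) (∑ᶻ (square ∘ h₀)) (∑ᶻ (square ∘ h₁)) ⟩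
  (ℤ.+ 2 ℤ.* ℤ.+ (2 ^ n)) ℤ.* (∑ᶻ (square ∘ h₀) ℤ.+ ∑ᶻ (square ∘ h₁))
    ≡⟨ cong (ℤ._* (∑ᶻ (square ∘ h₀) ℤ.+ ∑ᶻ (square ∘ h₁))) (ℤ.pos-* 2 (2 ^ n)) ⟨
  ℤ.+ (2 ^ suc n) ℤ.* ∑ᶻ (square ∘ h) ∎
  where
  open ≡-Reasoning
  square : ℤ → ℤ
  square z = z ℤ.* z
  h₀ h₁ U V : Vtx n → ℤ
  h₀ = h ∘ (false ∷_)
  h₁ = h ∘ (true ∷_)
  U = walsh h₀
  V = walsh h₁
  parallelogram : ∀ u v → (u ℤ.+ 1ℤ ℤ.* v) ℤ.* (u ℤ.+ 1ℤ ℤ.* v) ℤ.+ (u ℤ.+ -1ℤ ℤ.* v) ℤ.* (u ℤ.+ -1ℤ ℤ.* v)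
                        ≡ ℤ.+ 2 ℤ.* (u ℤ.* u ℤ.+ v ℤ.* v)
  parallelogram = ℤ-Solver.solve-∀
  factor : ∀ p a b → ℤ.+ 2 ℤ.* (p ℤ.* a ℤ.+ p ℤ.* b) ≡ (ℤ.+ 2 ℤ.* p) ℤ.* (a ℤ.+ b)
  factor = ℤ-Solver.solve-∀

-- Balanced functions cut at least 2ⁿ edges

Balanced : ∀ {n} → (Vtx n → Bool) → Set
Balanced {n} g = 2 * count g ≡ 2 ^ n

cut : ∀ {n} → (Vtx n → Bool) → Vtx n → ℕ
cut g a = ∑ λ x → bitDist (g x) (g (x ⊕ a))

spectrum : ∀ {n} → (Vtx n → Bool) → Vtx n → ℕ
spectrum g s = ∣ walsh (χ ∘ g) s ∣ * ∣ walsh (χ ∘ g) s ∣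

+∣z∣*∣z∣ : ∀ z → ℤ.+ (∣ z ∣ * ∣ z ∣) ≡ z ℤ.* z
+∣z∣*∣z∣ (ℤ.+ n)     = ℤ.pos-* n n
+∣z∣*∣z∣ ℤ.-[1+ n ] = refl

χ-square : ∀ b → χ b ℤ.* χ b ≡ 1ℤ
χ-square false = refl
χ-square true  = refl

χ-difference-square : ∀ b c → (χ b - χ c) ℤ.* (χ b - χ c) ≡ ℤ.+ (4 * bitDist b c)
χ-difference-square false false = refl
χ-difference-square false true  = refl
χ-difference-square true  false = refl
χ-difference-square true  true  = refl

reflection-square : ∀ p z → (z - χ p ℤ.* z) ℤ.* (z - χ p ℤ.* z) ≡ ℤ.+ (4 * (∣ z ∣ * ∣ z ∣ when p))
reflection-square false z = vanish z
  where
  vanish : ∀ z → (z - 1ℤ ℤ.* z) ℤ.* (z - 1ℤ ℤ.* z) ≡ ℤ.0ℤ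
  vanish = ℤ-Solver.solve-∀
reflection-square true  z =
  trans (quadruple z) (trans (cong (ℤ.+ 4 ℤ.*_) (sym (+∣z∣*∣z∣ z))) (sym (ℤ.pos-* 4 (∣ z ∣ * ∣ z ∣))))
  where
  quadruple : ∀ z → (z - -1ℤ ℤ.* z) ℤ.* (z - -1ℤ ℤ.* z) ≡ ℤ.+ 4 ℤ.* (z ℤ.* z)
  quadruple = ℤ-Solver.solve-∀

∑-spectrum : ∀ {n} (g : Vtx n → Bool) → ∑ (spectrum g) ≡ 2 ^ n * 2 ^ n
∑-spectrum {n} g = ℤ.+-injective (begin
  ℤ.+ ∑ (spectrum g)                     ≡⟨ ∑ᶻ-+ (spectrum g) ⟨
  ∑ᶻ (λ s → ℤ.+ spectrum g s)            ≡⟨ ∑ᶻ-cong (λ s → +∣z∣*∣z∣ (ĝ s)) ⟩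
  ∑ᶻ (λ s → ĝ s ℤ.* ĝ s)                 ≡⟨ parseval (χ ∘ g) ⟩
  ℤ.+ (2 ^ n) ℤ.* ∑ᶻ (λ x → χ (g x) ℤ.* χ (g x)) ≡⟨ cong (ℤ.+ (2 ^ n) ℤ.*_) (∑ᶻ-cong (χ-square ∘ g)) ⟩
  ℤ.+ (2 ^ n) ℤ.* ∑ᶻ {n} (λ _ → ℤ.+ 1)  ≡⟨ cong (ℤ.+ (2 ^ n) ℤ.*_) (∑ᶻ-+ {n} (λ _ → 1)) ⟩
  ℤ.+ (2 ^ n) ℤ.* ℤ.+ ∑ {n} (λ _ → 1)   ≡⟨ cong (λ k → ℤ.+ (2 ^ n) ℤ.* ℤ.+ k) (∑-ones n) ⟩
  ℤ.+ (2 ^ n) ℤ.* ℤ.+ (2 ^ n)           ≡⟨ ℤ.pos-* (2 ^ n) (2 ^ n) ⟨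
  ℤ.+ (2 ^ n * 2 ^ n)                    ∎)
  where
  open ≡-Reasoning
  ĝ : Vtx n → ℤ
  ĝ = walsh (χ ∘ g)

walsh-balanced-zeros : ∀ {n} (g : Vtx n → Bool) → Balanced g → walsh (χ ∘ g) (zeros n) ≡ ℤ.0ℤ
walsh-balanced-zeros {n} g balanced = trans (walsh-zeros (χ ∘ g)) (identityˡ-unique _ (ℤ.+ (2 ^ n)) (begin
  ∑ᶻ (χ ∘ g) ℤ.+ ℤ.+ (2 ^ n)                ≡⟨ cong (λ k → ∑ᶻ (χ ∘ g) ℤ.+ ℤ.+ k) balanced ⟨
  ∑ᶻ (χ ∘ g) ℤ.+ ℤ.+ (2 * count g)          ≡⟨ cong (λ k → ∑ᶻ (χ ∘ g) ℤ.+ ℤ.+ k) (*-distribˡ-∑ 2 ((1 when_) ∘ g)) ⟩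
  ∑ᶻ (χ ∘ g) ℤ.+ ℤ.+ ∑ (twice ∘ g)          ≡⟨ cong (λ k → ∑ᶻ (χ ∘ g) ℤ.+ k) (∑ᶻ-+ (twice ∘ g)) ⟨
  ∑ᶻ (χ ∘ g) ℤ.+ ∑ᶻ (ℤ.+_ ∘ twice ∘ g)      ≡⟨ ∑ᶻ-distrib-+ (χ ∘ g) (ℤ.+_ ∘ twice ∘ g) ⟨
  ∑ᶻ (λ x → χ (g x) ℤ.+ ℤ.+ twice (g x))    ≡⟨ ∑ᶻ-cong (χ+twice ∘ g) ⟩
  ∑ᶻ {n} (λ _ → ℤ.+ 1)                      ≡⟨ ∑ᶻ-+ {n} (λ _ → 1) ⟩
  ℤ.+ ∑ {n} (λ _ → 1)                       ≡⟨ cong ℤ.+_ (∑-ones n) ⟩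
  ℤ.+ (2 ^ n)                               ∎))
  where
  open ≡-Reasoning
  twice : Bool → ℕ
  twice b = 2 * (1 when b)
  χ+twice : ∀ b → χ b ℤ.+ ℤ.+ twice b ≡ ℤ.+ 1
  χ+twice false = refl
  χ+twice true  = refl

spectrum-balanced-zeros : ∀ {n} (g : Vtx n → Bool) → Balanced g → spectrum g (zeros n) ≡ 0
spectrum-balanced-zeros g balanced = cong (λ z → ∣ z ∣ * ∣ z ∣) (walsh-balanced-zeros g balanced)

-- Parseval for k x = (-1)^g(x) - (-1)^g(x ⊕ a), whose transform is (1 - (-1)^(s·a)) ĝ(s).
spectrum-cut : ∀ {n} (g : Vtx n → Bool) (a : Vtx n) → ∑ (λ s → spectrum g s when (s · a)) ≡ 2 ^ n * cut g a
spectrum-cut {n} g a = *-cancelˡ-≡ _ _ 4 (ℤ.+-injective (begin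
  ℤ.+ (4 * ∑ F)                                  ≡⟨ cong ℤ.+_ (*-distribˡ-∑ 4 F) ⟩
  ℤ.+ ∑ (λ s → 4 * F s)                          ≡⟨ ∑ᶻ-+ (λ s → 4 * F s) ⟨
  ∑ᶻ (λ s → ℤ.+ (4 * F s))                       ≡⟨ ∑ᶻ-cong walsh-k-square ⟨
  ∑ᶻ (λ s → walsh k s ℤ.* walsh k s)             ≡⟨ parseval k ⟩
  ℤ.+ (2 ^ n) ℤ.* ∑ᶻ (λ x → k x ℤ.* k x)         ≡⟨ cong (ℤ.+ (2 ^ n) ℤ.*_) (∑ᶻ-cong k-square) ⟩
  ℤ.+ (2 ^ n) ℤ.* ∑ᶻ (λ x → ℤ.+ (4 * D x))       ≡⟨ cong (ℤ.+ (2 ^ n) ℤ.*_) (∑ᶻ-+ (λ x → 4 * D x)) ⟩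
  ℤ.+ (2 ^ n) ℤ.* ℤ.+ ∑ (λ x → 4 * D x)          ≡⟨ cong (λ t → ℤ.+ (2 ^ n) ℤ.* ℤ.+ t) (*-distribˡ-∑ 4 D) ⟨
  ℤ.+ (2 ^ n) ℤ.* ℤ.+ (4 * cut g a)              ≡⟨ ℤ.pos-* (2 ^ n) (4 * cut g a) ⟨
  ℤ.+ (2 ^ n * (4 * cut g a))                    ≡⟨ cong ℤ.+_ (*-left-comm (2 ^ n) 4 (cut g a)) ⟩
  ℤ.+ (4 * (2 ^ n * cut g a))                    ∎))
  where
  open ≡-Reasoning
  F D : Vtx n → ℕ
  F s = spectrum g s when (s · a)
  D x = bitDist (g x) (g (x ⊕ a))
  ĝ k : Vtx n → ℤ
  ĝ = walsh (χ ∘ g)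
  k x = χ (g x) - χ (g (x ⊕ a))
  k-square : ∀ x → k x ℤ.* k x ≡ ℤ.+ (4 * D x)
  k-square x = χ-difference-square (g x) (g (x ⊕ a))
  walsh-k-square : ∀ s → walsh k s ℤ.* walsh k s ≡ ℤ.+ (4 * F s)
  walsh-k-square s =
    trans (cong (λ z → z ℤ.* z) (trans (walsh-sub (χ ∘ g) (λ x → χ (g (x ⊕ a))) s)
                                       (cong (ĝ s -_) (walsh-translate a (χ ∘ g) s))))
          (reflection-square (s · a) (ĝ s))

∑ₑ-· : ∀ {n} (s : Vtx n) → ∑ₑ (λ a → 1 when (s · a)) ≡ weight s
∑ₑ-· []          = refl
∑ₑ-· (false ∷ s) = cong₂ _+_ (cong (1 when_) (·-zerosʳ s)) (∑ₑ-· s)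
∑ₑ-· (true ∷ s)  = cong₂ _+_ (cong (λ p → 1 when not p) (·-zerosʳ s)) (∑ₑ-· s)

2≤weight+parity : ∀ {n} (s : Vtx n) → s ≢ zeros n → 2 ≤ weight s + 1 when (s · ones n)
2≤weight+parity []      s≢0 = ⊥-elim (s≢0 refl)
2≤weight+parity {suc n} (b ∷ s) s≢0 with s ≟ᵛ zeros n
2≤weight+parity {suc n} (false ∷ s) s≢0 | yes refl = ⊥-elim (s≢0 refl)
2≤weight+parity {suc n} (true ∷ s)  s≢0 | yes refl rewrite weight-zeros n | ·-zerosˡ (ones n) = ≤-refl
2≤weight+parity {suc n} (false ∷ s) s≢0 | no s′≢0  = 2≤weight+parity s s′≢0
2≤weight+parity {suc n} (true ∷ s)  s≢0 | no s′≢0  = flip-parity (weight s) (s · ones n) (2≤weight+parity s s′≢0)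
  where
  flip-parity : ∀ w p → 2 ≤ w + 1 when p → 2 ≤ suc w + 1 when not p
  flip-parity w true  2≤w+1 = ≤-trans 2≤w+1 (≤-reflexive (trans (+-comm w 1) (sym (+-identityʳ (suc w)))))
  flip-parity w false 2≤w+0 = ≤-trans 2≤w+0 (+-mono-≤ (n≤1+n w) z≤n)

2≤∑ₛ-· : ∀ {n} (s : Vtx n) → s ≢ zeros n → 2 ≤ ∑ₛ (λ a → 1 when (s · a))
2≤∑ₛ-· {n} s s≢0 = ≤-trans (2≤weight+parity s s≢0) (≤-reflexive (cong (_+ 1 when (s · ones n)) (sym (∑ₑ-· s))))

∑ₛ-when : ∀ {n} c (P : Vtx n → Bool) → ∑ₛ (λ a → c when P a) ≡ ∑ₛ (λ a → 1 when P a) * c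
∑ₛ-when c P = trans (∑ₛ-cong λ a → when-* c (P a))
                    (trans (sym (*-distribˡ-∑ₛ c λ a → 1 when P a)) (*-comm c _))

bisection-bound : ∀ {n} (g : Vtx n → Bool) → Balanced g → 2 * 2 ^ n ≤ arcSum (λ x y → bitDist (g x) (g y))
bisection-bound {n} g balanced = *-cancelˡ-≤ (2 ^ n) {{m^n≢0 2 n}} (begin
  2 ^ n * (2 * 2 ^ n)                          ≡⟨ *-left-comm (2 ^ n) 2 (2 ^ n) ⟩
  2 * (2 ^ n * 2 ^ n)                          ≡⟨ cong (2 *_) (∑-spectrum g) ⟨
  2 * ∑ F                                      ≡⟨ *-distribˡ-∑ 2 F ⟩
  ∑ (λ s → 2 * F s)                            ≤⟨ ∑-mono doubled-term ⟩
  ∑ (λ s → ∑ₛ λ a → F s when (s · a))          ≡⟨ ∑ₛ-∑-comm (λ a s → F s when (s · a)) ⟨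
  ∑ₛ (λ a → ∑ λ s → F s when (s · a))          ≡⟨ ∑ₛ-cong (spectrum-cut g) ⟩
  ∑ₛ (λ a → 2 ^ n * cut g a)                   ≡⟨ *-distribˡ-∑ₛ (2 ^ n) (cut g) ⟨
  2 ^ n * ∑ₛ (cut g)                           ≡⟨ cong (2 ^ n *_) (∑ₛ-∑-comm λ a x → bitDist (g x) (g (x ⊕ a))) ⟩
  2 ^ n * arcSum (λ x y → bitDist (g x) (g y)) ∎)
  where
  open ≤-Reasoning
  F : Vtx n → ℕ
  F = spectrum g
  doubled-term : ∀ s → 2 * F s ≤ ∑ₛ (λ a → F s when (s · a))
  doubled-term s with s ≟ᵛ zeros n
  ... | yes refl rewrite spectrum-balanced-zeros g balanced = z≤n
  ... | no s≢0 = ≤-trans (*-monoˡ-≤ (F s) (2≤∑ₛ-· s s≢0)) (≤-reflexive (sym (∑ₛ-when (F s) (s ·_))))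

-- The lower bound

Balanced-cong : ∀ {n} {g g′ : Vtx n → Bool} → (∀ x → g x ≡ g′ x) → Balanced g → Balanced g′
Balanced-cong g≗g′ = trans (cong (2 *_) (∑-cong λ x → cong (1 when_) (sym (g≗g′ x))))

coordinate-balanced : ∀ {n} (i : Fin n) → Balanced (λ y → lookup y i)
coordinate-balanced {suc n} zero    = cong (2 *_) (cong₂ _+_ (∑-zero n) (∑-ones n))
coordinate-balanced {suc n} (suc i) = cong (2 *_) (trans (cong (c +_) (sym (+-identityʳ c))) (coordinate-balanced i))
  where
  c : ℕ
  c = count λ y → lookup y i

injective⇒coordinate-balanced : ∀ {n} {f : Vtx n → Vtx n} → Injective _≡_ _≡_ f →
                                ∀ i → Balanced (λ x → lookup (f x) i)
injective⇒coordinate-balanced f-inj i =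
  trans (cong (2 *_) (∑-reindex f-inj (λ y → 1 when lookup y i))) (coordinate-balanced i)

lookup-suc : ∀ {n} (v : Vtx (suc n)) i → lookup v (suc i) ≡ lookup (tail v) i
lookup-suc (a ∷ v) i = refl

arcSum-hamming-bound : ∀ {n m} (f : Vtx n → Vtx m) → (∀ i → Balanced (λ x → lookup (f x) i)) →
                       m * (2 * 2 ^ n) ≤ arcSum (λ x y → hamming (f x) (f y))
arcSum-hamming-bound {n} {zero}  f _        = z≤n
arcSum-hamming-bound {n} {suc m} f balanced = begin
  2 * 2 ^ n + m * (2 * 2 ^ n)                  ≤⟨ +-mono-≤ (bisection-bound f₀ (balanced zero))
                                                            (arcSum-hamming-bound f₊ balanced₊) ⟩
  arcSum (λ x y → bitDist (f₀ x) (f₀ y)) + arcSum (λ x y → hamming (f₊ x) (f₊ y))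
    ≡⟨ arcSum-distrib-+ (λ x y → bitDist (f₀ x) (f₀ y)) (λ x y → hamming (f₊ x) (f₊ y)) ⟨
  arcSum (λ x y → bitDist (f₀ x) (f₀ y) + hamming (f₊ x) (f₊ y))
    ≡⟨ ∑-cong (λ x → ∑ₛ-cong λ a → hamming-lookup-tail (f x) (f (x ⊕ a))) ⟨
  arcSum (λ x y → hamming (f x) (f y))         ∎
  where
  open ≤-Reasoning
  f₀ : Vtx n → Bool
  f₀ x = lookup (f x) zero
  f₊ : Vtx n → Vtx m
  f₊ = tail ∘ f
  balanced₊ : ∀ i → Balanced (λ x → lookup (f₊ x) i)
  balanced₊ i = Balanced-cong (λ x → lookup-suc (f x) i) (balanced (suc i))

n*2^n≤wirelength : ∀ m (E : Embedding (2 + m)) → (2 + m) * 2 ^ (2 + m) ≤ wirelength E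
n*2^n≤wirelength m E = *-cancelˡ-≤ 2 (begin
  2 * (n * 2 ^ n)                           ≡⟨ *-left-comm 2 n (2 ^ n) ⟩
  n * (2 * 2 ^ n)                           ≤⟨ arcSum-hamming-bound f (injective⇒coordinate-balanced f-inj) ⟩
  arcSum (λ x y → hamming (f x) (f y))      ≡⟨ arcSum≡2*edgeSum {m} _ (λ x y → hamming-sym (f x) (f y)) ⟩
  2 * edgeSum (λ x y → hamming (f x) (f y)) ≤⟨ *-monoʳ-≤ 2 (edgeSum≤wirelength E) ⟩
  2 * wirelength E                          ∎)
  where
  open ≤-Reasoning
  open Embedding E
  n : ℕ
  n = 2 + m

theorem6p1 : (n : ℕ) → 2 ≤ n → IsMinWirelength n (n * 2 ^ n)
theorem6p1 (suc (suc m)) _ = (geodesicEmbedding (2 + m) , wirelength-geodesicEmbedding m) , n*2^n≤wirelength m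
theorem6p1 (suc zero) (s≤s ())
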